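{- $\mathbb{P}(K_3)$ is paraconsistent: there exist $\Gamma\subseteq For$ and $\alpha\in For$ such that $\{\alpha,\neg\alpha\}\subseteq Cn^{\mathbb{P}}_{K_3}(\Gamma)$ but $Cn^{\mathbb{P}}_{K_3}(\Gamma)\neq For$.
   Context: $For$ is the set of formulas built from a countable set $Prop$ of propositional letters with $\neg,\vee,\wedge,\rightarrow$. $K_3$ (Kleene) is given by the matrix with truth values $\{0,1/2,1\}$, designated set $\{1\}$, $f_\neg(x)=1-x$, $f_\vee=\max$, $f_\wedge=\min$, $f_\rightarrow(x,y)=\max\{1-x,y\}$; valuations are maps $Prop\to\{0,1/2,1\}$ extended via these functions. $\Gamma\vDash_{K_3}\alpha$ iff every valuation giving all members of $\Gamma$ value $1$ gives $\alpha$ value $1$; $\Gamma$ is $K_3$-consistent iff $\{\alpha:\Gamma\vDash_{K_3}\alpha\}\neq For$. $\Gamma\vDash^{\mathbb{P}}_{K_3}\alpha$ iff there exists a $K_3$-consistent $\Gamma'\subseteq\Gamma$ with $\Gamma'\vDash_{K_3}\alpha$; $Cn^{\mathbb{P}}_{K_3}(\Gamma)=\{\alpha:\Gamma\vDash^{\mathbb{P}}_{K_3}\alpha\}$. -}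

module Defs where

open import Data.Nat using (ℕ)
open import Data.Product using (∃)
open import Relation.Binary.PropositionalEquality using (_≡_)
open import Relation.Nullary using (¬_)

Prop : Set
Prop = ℕ

data For : Set where
  var  : Prop → For
  ¬'_  : For → For
  _∨'_ : For → For → For
  _∧'_ : For → For → For
  _⇒'_ : For → For → For

-- Truth values {0, 1/2, 1}.
data V3 : Set where
  v0 vh v1 : V3

neg3 : V3 → V3
neg3 v0 = v1
neg3 vh = vh
neg3 v1 = v0

max3 : V3 → V3 → V3
max3 v0 y  = y
max3 vh v0 = vh
max3 vh vh = vh
max3 vh v1 = v1
max3 v1 y  = v1

min3 : V3 → V3 → V3
min3 v0 y  = v0
min3 vh v0 = v0
min3 vh vh = vh
min3 vh v1 = vh
min3 v1 y  = y

imp3 : V3 → V3 → V3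
imp3 x y = max3 (neg3 x) y

Valuation : Set
Valuation = Prop → V3

eval : Valuation → For → V3
eval v (var p)   = v p
eval v (¬' a)    = neg3 (eval v a)
eval v (a ∨' b)  = max3 (eval v a) (eval v b)
eval v (a ∧' b)  = min3 (eval v a) (eval v b)
eval v (a ⇒' b)  = imp3 (eval v a) (eval v b)

FSet : Set₁
FSet = For → Set

_⊆_ : FSet → FSet → Set
Γ ⊆ Δ = ∀ φ → Γ φ → Δ φ

_⊨K3_ : FSet → For → Set
Γ ⊨K3 α = ∀ (v : Valuation) → (∀ φ → Γ φ → eval v φ ≡ v1) → eval v α ≡ v1

K3-consistent : FSet → Set
K3-consistent Γ = ∃ λ β → ¬ (Γ ⊨K3 β)

_⊨P_ : FSet → For → Set₁
Γ ⊨P α = ∃ λ (Γ' : FSet) → (Γ' ⊆ Γ) × K3-consistent Γ' × (Γ' ⊨K3 α)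
  where open import Data.Product using (_×_)

CnP : FSet → For → Set₁
CnP Γ α = Γ ⊨P α

-- Γ = {p, ¬p} is K3-inconsistent, but each singleton is K3-consistent, so both p and ¬p are
-- P(K3)-consequences of Γ. A letter q outside Γ is not: resetting q to 0 in any model of a
-- subset of Γ keeps it a model, so a subset entailing q would have no models at all and
-- would therefore entail everything.
module Submission where

open import Defs
open import Data.Bool using (if_then_else_)
open import Data.Empty using (⊥-elim)
open import Data.Nat using (zero; suc; _≡ᵇ_)
open import Data.Product using (Σ; ∃; _×_; _,_)
open import Data.Sum using (_⊎_; inj₁; inj₂)
open import Relation.Binary.PropositionalEquality using (_≡_; _≢_; refl; sym; trans)
open import Relation.Nullary using (¬_)

_[_≔_] : Valuation → Prop → V3 → Valuation
(v [ n ≔ x ]) m = if m ≡ᵇ n then x else v m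

Models : Valuation → FSet → Set
Models v Γ = ∀ φ → Γ φ → eval v φ ≡ v1

｛_｝ : For → FSet
｛ φ ｝ ψ = ψ ≡ φ

_∪_ : FSet → FSet → FSet
(Γ ∪ Δ) φ = Γ φ ⊎ Δ φ

v0≢v1 : v0 ≢ v1
v0≢v1 ()

∈⇒⊨K3 : ∀ {Γ φ} → Γ φ → Γ ⊨K3 φ
∈⇒⊨K3 {φ = φ} φ∈Γ v v⊨Γ = v⊨Γ φ φ∈Γ

model⇒K3-consistent : ∀ {Γ} v β → Models v Γ → eval v β ≢ v1 → K3-consistent Γ
model⇒K3-consistent v β v⊨Γ v⊭β = β , λ Γ⊨β → v⊭β (Γ⊨β v v⊨Γ)

eval-reset-var : ∀ v n → eval (v [ n ≔ v0 ]) (var n) ≡ v0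
eval-reset-var v zero    = refl
eval-reset-var v (suc n) = eval-reset-var (λ m → v (suc m)) n

IndependentOf : Prop → FSet → Set
IndependentOf n Γ = ∀ v φ → Γ φ → eval (v [ n ≔ v0 ]) φ ≡ eval v φ

K3-consistent⇒⊭fresh-var : ∀ {Γ n} → IndependentOf n Γ → K3-consistent Γ → ¬ (Γ ⊨K3 var n)
K3-consistent⇒⊭fresh-var {Γ} {n} indep (β , Γ⊭β) Γ⊨n = Γ⊭β λ v v⊨Γ →
  ⊥-elim (v0≢v1 (trans (sym (eval-reset-var v n)) (Γ⊨n (v [ n ≔ v0 ]) (reset-models v v⊨Γ))))
  where
  reset-models : ∀ v → Models v Γ → Models (v [ n ≔ v0 ]) Γ
  reset-models v v⊨Γ φ φ∈Γ = trans (indep v φ φ∈Γ) (v⊨Γ φ φ∈Γ)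

IndependentOf-⊆ : ∀ {Δ Γ n} → Δ ⊆ Γ → IndependentOf n Γ → IndependentOf n Δ
IndependentOf-⊆ Δ⊆Γ indep v φ φ∈Δ = indep v φ (Δ⊆Γ φ φ∈Δ)

⊭P-fresh-var : ∀ {Γ n} → IndependentOf n Γ → ¬ (Γ ⊨P var n)
⊭P-fresh-var indep (Γ′ , Γ′⊆Γ , consistent , Γ′⊨n) =
  K3-consistent⇒⊭fresh-var (IndependentOf-⊆ Γ′⊆Γ indep) consistent Γ′⊨n

member-with-consistent-singleton⇒⊨P : ∀ {Γ φ} → Γ φ → K3-consistent ｛ φ ｝ → Γ ⊨P φ
member-with-consistent-singleton⇒⊨P {φ = φ} φ∈Γ consistent =
  ｛ φ ｝ , (λ { ψ refl → φ∈Γ }) , consistent , ∈⇒⊨K3 refl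

p q : For
p = var 0
q = var 1

｛p｝-K3-consistent : K3-consistent ｛ p ｝
｛p｝-K3-consistent = model⇒K3-consistent ((λ _ → v0) [ 0 ≔ v1 ]) q (λ { ψ refl → refl }) v0≢v1

｛¬p｝-K3-consistent : K3-consistent ｛ ¬' p ｝
｛¬p｝-K3-consistent = model⇒K3-consistent (λ _ → v0) q (λ { ψ refl → refl }) v0≢v1

｛p,¬p｝-independent-of-q : IndependentOf 1 (｛ p ｝ ∪ ｛ ¬' p ｝)
｛p,¬p｝-independent-of-q v .p        (inj₁ refl) = refl
｛p,¬p｝-independent-of-q v .(¬' p)   (inj₂ refl) = refl

proposition21 : Σ FSet λ Γ → Σ For λ α →
    CnP Γ α × CnP Γ (¬' α) × (∃ λ β → ¬ (CnP Γ β))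
proposition21 = ｛ p ｝ ∪ ｛ ¬' p ｝ , p ,
  member-with-consistent-singleton⇒⊨P (inj₁ refl) ｛p｝-K3-consistent ,
  member-with-consistent-singleton⇒⊨P (inj₂ refl) ｛¬p｝-K3-consistent ,
  q , ⊭P-fresh-var ｛p,¬p｝-independent-of-q
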